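{- The multivalued map $\operatorname{UpperBound}:\mathbf{COrd}\rightrightarrows(\mathrm{cord},\delta_{\mathrm{K}})$, defined by $\beta\in\operatorname{UpperBound}(\alpha)$ iff $\beta\geq\alpha$, is computable.
   Context: A represented space is a pair $(X,\delta_X)$ with $\delta_X:\subseteq\mathbb{N}^\mathbb{N}\to X$ a partial surjection; a multivalued map is computable if some computable $F:\subseteq\mathbb{N}^\mathbb{N}\to\mathbb{N}^\mathbb{N}$ maps every name of an input to a name of some admissible output. $\mathrm{cord}$ is the set of countable ordinals. $\mathbf{COrd}=(\mathrm{cord},\delta_{\mathrm{nK}})$ with $\delta_{\mathrm{nK}}(0p)=0$, $\delta_{\mathrm{nK}}(1p)=\delta_{\mathrm{nK}}(p)+1$, $\delta_{\mathrm{nK}}(2\langle p_0,p_1,\ldots\rangle)=\sup_{i}\delta_{\mathrm{nK}}(p_i)$, with $\langle\ldots\rangle$ a standard computable tupling on $\mathbb{N}^\mathbb{N}$. $\delta_{\mathrm{K}}:\subseteq\mathbb{N}^\mathbb{N}\to\mathrm{cord}$ is defined inductively by $\delta_{\mathrm{K}}(0p)=0$, $\delta_{\mathrm{K}}(1p)=\delta_{\mathrm{K}}(p)+1$, and $\delta_{\mathrm{K}}(2\langle p_0,p_1,\ldots\rangle)=\sup_i\delta_{\mathrm{K}}(p_i)$ provided $\delta_{\mathrm{K}}(p_i)<\delta_{\mathrm{K}}(p_{i+1})$ for all $i$. -}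

module Defs where

open import Data.Nat using (ℕ; zero; suc; _+_; _<_)
open import Data.Fin using (Fin)
open import Data.Vec using (Vec; []; _∷_; lookup)
open import Data.Product using (Σ; _×_)
open import Relation.Binary.PropositionalEquality using (_≡_)

Baire : Set
Baire = ℕ → ℕ

tail : Baire → Baire
tail p n = p (suc n)

-- Cantor pairing  ⟨i , j⟩ = (i+j)(i+j+1)/2 + j
tri : ℕ → ℕ
tri zero    = 0
tri (suc n) = suc n + tri n

pair : ℕ → ℕ → ℕ
pair i j = tri (i + j) + j

-- Standard tupling ⟨p₀ , p₁ , …⟩ (k) with ⟨p₀,p₁,…⟩(⟨i,j⟩) = pᵢ(j).
-- As Cantor pairing is a bijection, every q is a tuple, and its i-th
-- component is  j ↦ q ⟨i,j⟩.  For p = 2⟨p₀,p₁,…⟩, the i-th component is: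
comp : Baire → ℕ → Baire
comp p i j = p (suc (pair i j))

-- Countable ordinals as Brouwer trees (lim f denotes sup of f i)

data Ord : Set where
  ozero : Ord
  osuc  : Ord → Ord
  olim  : (ℕ → Ord) → Ord

data _≤ₒ_ : Ord → Ord → Set where
  z≤   : ∀ {b} → ozero ≤ₒ b
  s≤s  : ∀ {a b} → a ≤ₒ b → osuc a ≤ₒ osuc b
  ≤lim : ∀ {a f} (i : ℕ) → a ≤ₒ f i → a ≤ₒ olim f
  lim≤ : ∀ {f b} → (∀ i → f i ≤ₒ b) → olim f ≤ₒ b

_<ₒ_ : Ord → Ord → Set
a <ₒ b = osuc a ≤ₒ b

-- The representations.  δ p ≡ α  is encoded as the (functional) relation.

data NK : Baire → Ord → Set where
  nk0 : ∀ {p} → p 0 ≡ 0 → NK p ozero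
  nk1 : ∀ {p α} → p 0 ≡ 1 → NK (tail p) α → NK p (osuc α)
  nk2 : ∀ {p} (αs : ℕ → Ord) → p 0 ≡ 2 →
        (∀ i → NK (comp p i) (αs i)) → NK p (olim αs)

data K : Baire → Ord → Set where
  k0 : ∀ {p} → p 0 ≡ 0 → K p ozero
  k1 : ∀ {p α} → p 0 ≡ 1 → K (tail p) α → K p (osuc α)
  k2 : ∀ {p} (αs : ℕ → Ord) → p 0 ≡ 2 →
       (∀ i → K (comp p i) (αs i)) →
       (∀ i → αs i <ₒ αs (suc i)) → K p (olim αs)

-- Computability on Baire space: oracle partial (μ-)recursive functions.
-- F : ⊆ ℕ^ℕ → ℕ^ℕ is computable iff F(p)(n) = Φ_e^p(n) for some code e.

data PR : ℕ → Set where
  Z   : ∀ {n} → PR n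
  S   : PR 1
  P   : ∀ {n} → Fin n → PR n
  O   : PR 1
  C   : ∀ {m n} → PR m → Vec (PR n) m → PR n
  R   : ∀ {n} → PR n → PR (suc (suc n)) → PR (suc n)
  M   : ∀ {n} → PR (suc n) → PR n

mutual
  data Eval (p : Baire) : ∀ {n} → PR n → Vec ℕ n → ℕ → Set where
    eZ : ∀ {n} {xs : Vec ℕ n} → Eval p Z xs 0
    eS : ∀ {x} → Eval p S (x ∷ []) (suc x)
    eP : ∀ {n} {i : Fin n} {xs} → Eval p (P i) xs (lookup xs i)
    eO : ∀ {x} → Eval p O (x ∷ []) (p x)
    eC : ∀ {m n} {f : PR m} {gs : Vec (PR n) m} {xs ys v} →
         EvalV p gs xs ys → Eval p f ys v → Eval p (C f gs) xs v
    eR0 : ∀ {n} {f : PR n} {g xs v} →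
          Eval p f xs v → Eval p (R f g) (0 ∷ xs) v
    eRs : ∀ {n} {f : PR n} {g xs k u v} →
          Eval p (R f g) (k ∷ xs) u → Eval p g (k ∷ u ∷ xs) v →
          Eval p (R f g) (suc k ∷ xs) v
    eM : ∀ {n} {f : PR (suc n)} {xs x} →
         Eval p f (x ∷ xs) 0 →
         (∀ y → y < x → Σ ℕ (λ w → Eval p f (y ∷ xs) (suc w))) →
         Eval p (M f) xs x

  data EvalV (p : Baire) {n : ℕ} : ∀ {m} → Vec (PR n) m → Vec ℕ n → Vec ℕ m → Set where
    [] : ∀ {xs} → EvalV p [] xs []
    _∷_ : ∀ {m} {g : PR n} {gs : Vec (PR n) m} {xs y ys} →
          Eval p g xs y → EvalV p gs xs ys → EvalV p (g ∷ gs) xs (y ∷ ys)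

Computes : PR 1 → Baire → Baire → Set
Computes e p q = ∀ n → Eval p e (n ∷ []) (q n)

UpperBoundComputable : Set
UpperBoundComputable =
  Σ (PR 1) λ e → ∀ p α → NK p α →
    Σ Baire λ q → Computes e p q × Σ Ord λ β → K q β × (α ≤ₒ β)

-- A δ_nK-name is translated, subtree by subtree and relative to a
-- continuation name of some κ, into a δ_K-name of an upper bound of both its
-- ordinal and κ: 0p becomes the continuation, 1p becomes 1 followed by the
-- translation of p, and 2⟨p₀,p₁,…⟩ becomes 2⟨1r₀,1r₁,…⟩ where rᵢ translates pᵢ
-- with continuation 1rᵢ₋₁ (and the given one for i = 0).  Then rᵢ₊₁ names an
-- ordinal at least that of 1rᵢ, so the limit sequence is strictly increasing,
-- as δ_K demands.  Digit n of the translation is found by tracing n back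
-- through the input tree in at most n steps, which makes the translation
-- primitive recursive in the input apart from Cantor unpairing.

module Submission where

open import Defs
open import Data.Nat using (ℕ; zero; suc; _+_; _∸_; _<_; _≤_; z≤n; s≤s; pred)
open import Data.Nat.Properties
open import Data.Nat.GeneralisedArithmetic using (fold)
open import Data.Fin using (Fin) renaming (zero to fz; suc to fs)
open import Data.Vec using (Vec; []; _∷_; lookup)
open import Data.Product using (Σ; _×_; _,_; proj₁; proj₂)
open import Relation.Binary.PropositionalEquality

record Computable (n : ℕ) (f : Baire → Vec ℕ n → ℕ) : Set where
  constructor computable
  field
    program   : PR n
    evaluates : ∀ p xs → Eval p program xs (f p xs)
open Computable

Computable₁ : (Baire → ℕ → ℕ) → Set
Computable₁ f = Computable 1 (λ p xs → f p (lookup xs fz))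

Computable₂ : (Baire → ℕ → ℕ → ℕ) → Set
Computable₂ f = Computable 2 (λ p xs → f p (lookup xs fz) (lookup xs (fs fz)))

module _ {n : ℕ} where

  computable-ext : ∀ {f g} → Computable n f → (∀ p xs → f p xs ≡ g p xs) → Computable n g
  computable-ext (computable e ev) f≗g = computable e (λ p xs → subst (Eval p e xs) (f≗g p xs) (ev p xs))

  app₁ : ∀ {f a} → Computable 1 f → Computable n a →
         Computable n (λ p xs → f p (a p xs ∷ []))
  app₁ (computable e ev) (computable a eva) =
    computable (C e (a ∷ [])) (λ p xs → eC (eva p xs ∷ []) (ev p _))

  app₂ : ∀ {f a b} → Computable 2 f → Computable n a → Computable n b →
         Computable n (λ p xs → f p (a p xs ∷ b p xs ∷ []))
  app₂ (computable e ev) (computable a eva) (computable b evb) =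
    computable (C e (a ∷ b ∷ [])) (λ p xs → eC (eva p xs ∷ evb p xs ∷ []) (ev p _))

  app₃ : ∀ {f a b c} → Computable 3 f → Computable n a → Computable n b → Computable n c →
         Computable n (λ p xs → f p (a p xs ∷ b p xs ∷ c p xs ∷ []))
  app₃ (computable e ev) (computable a eva) (computable b evb) (computable c evc) =
    computable (C e (a ∷ b ∷ c ∷ [])) (λ p xs → eC (eva p xs ∷ evb p xs ∷ evc p xs ∷ []) (ev p _))

  zeroᶜ : Computable n (λ _ _ → 0)
  zeroᶜ = computable Z (λ _ _ → eZ)

  var : (i : Fin n) → Computable n (λ _ xs → lookup xs i)
  var i = computable (P i) (λ _ _ → eP)

sucᶜ : Computable₁ (λ _ → suc)
sucᶜ = computable S (λ { p (x ∷ []) → eS })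

oracleᶜ : Computable₁ (λ p → p)
oracleᶜ = computable O (λ { p (x ∷ []) → eO })

constᶜ : ∀ {n} (k : ℕ) → Computable n (λ _ _ → k)
constᶜ zero    = zeroᶜ
constᶜ (suc k) = app₁ sucᶜ (constᶜ k)

#0 : ∀ {n} → Computable (suc n) (λ _ xs → lookup xs fz)
#0 = var fz
#1 : ∀ {n} → Computable (suc (suc n)) (λ _ xs → lookup xs (fs fz))
#1 = var (fs fz)
#3 : ∀ {n} → Computable (suc (suc (suc (suc n)))) (λ _ xs → lookup xs (fs (fs (fs fz))))
#3 = var (fs (fs (fs fz)))

primRec : ∀ {n} → (Vec ℕ n → ℕ) → (Vec ℕ (suc (suc n)) → ℕ) → Vec ℕ (suc n) → ℕ
primRec f g (zero  ∷ xs) = f xs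
primRec f g (suc k ∷ xs) = g (k ∷ primRec f g (k ∷ xs) ∷ xs)

primRecᶜ : ∀ {n f g} → Computable n f → Computable (suc (suc n)) g →
           Computable (suc n) (λ p → primRec (f p) (g p))
primRecᶜ {f = f} {g} (computable e ev) (computable d evd) = computable (R e d) evaluates-rec
  where
  evaluates-rec : ∀ p xs → Eval p (R e d) xs (primRec (f p) (g p) xs)
  evaluates-rec p (zero  ∷ xs) = eR0 (ev p xs)
  evaluates-rec p (suc k ∷ xs) = eRs (evaluates-rec p (k ∷ xs)) (evd p _)

minimiseᶜ : ∀ {n f} → Computable (suc n) f → (w : Baire → Vec ℕ n → ℕ) →
            (∀ p xs → f p (w p xs ∷ xs) ≡ 0) →
            (∀ p xs y → y < w p xs → Σ ℕ λ v → f p (y ∷ xs) ≡ suc v) → Computable n w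
minimiseᶜ (computable e ev) w root below = computable (M e) λ p xs →
  eM (subst (Eval p e _) (root p xs) (ev p _))
     (λ y y<w → proj₁ (below p xs y y<w) , subst (Eval p e _) (proj₂ (below p xs y y<w)) (ev p _))

ifz : ℕ → ℕ → ℕ → ℕ
ifz zero    a b = a
ifz (suc _) a b = b

ifz-elim : ∀ (B : ℕ → Set) c {a b} → B a → B b → B (ifz c a b)
ifz-elim B zero    ba bb = ba
ifz-elim B (suc c) ba bb = bb

ifzᶜ : Computable 3 (λ _ xs → ifz (lookup xs fz) (lookup xs (fs fz)) (lookup xs (fs (fs fz))))
ifzᶜ = computable-ext (primRecᶜ #0 #3) λ { p (zero ∷ a ∷ b ∷ []) → refl ; p (suc c ∷ a ∷ b ∷ []) → refl }

predᶜ : Computable₁ (λ _ → pred)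
predᶜ = computable-ext (primRecᶜ zeroᶜ #0) λ { p (zero ∷ []) → refl ; p (suc a ∷ []) → refl }

+ᶜ : Computable₂ (λ _ → _+_)
+ᶜ = computable-ext (primRecᶜ #0 (app₁ sucᶜ #1)) (λ { p (a ∷ b ∷ []) → primRec≡+ a b })
  where
  primRec≡+ : ∀ a b → primRec (λ xs → lookup xs fz) (λ xs → suc (lookup xs (fs fz))) (a ∷ b ∷ []) ≡ a + b
  primRec≡+ zero    b = refl
  primRec≡+ (suc a) b = cong suc (primRec≡+ a b)

∸ᶜ : Computable₂ (λ _ → _∸_)
∸ᶜ = computable-ext (app₂ (primRecᶜ #0 (app₁ predᶜ #1)) #1 #0) (λ { p (a ∷ b ∷ []) → primRec≡∸ b a })
  where
  primRec≡∸ : ∀ b a → primRec (λ xs → lookup xs fz) (λ xs → pred (lookup xs (fs fz))) (b ∷ a ∷ []) ≡ a ∸ b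
  primRec≡∸ zero    a = refl
  primRec≡∸ (suc b) a = trans (cong pred (primRec≡∸ b a)) (pred[m∸n]≡m∸[1+n] a b)

triᶜ : Computable₁ (λ _ → tri)
triᶜ = computable-ext (primRecᶜ zeroᶜ (app₂ +ᶜ (app₁ sucᶜ #0) #1)) (λ { p (a ∷ []) → primRec≡tri a })
  where
  primRec≡tri : ∀ a → primRec (λ _ → 0) (λ xs → suc (lookup xs fz) + lookup xs (fs fz)) (a ∷ []) ≡ tri a
  primRec≡tri zero    = refl
  primRec≡tri (suc a) = cong (suc a +_) (primRec≡tri a)

foldᶜ : ∀ {f} → Computable₁ f → Computable₂ (λ p n s → fold s (f p) n)
foldᶜ {f} c = computable-ext (primRecᶜ #0 (app₁ c #1)) (λ { p (n ∷ s ∷ []) → primRec≡fold p n s })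
  where
  primRec≡fold : ∀ p n s → primRec (λ xs → lookup xs fz) (λ xs → f p (lookup xs (fs fz))) (n ∷ s ∷ []) ≡ fold s (f p) n
  primRec≡fold p zero    s = refl
  primRec≡fold p (suc n) s = cong (f p) (primRec≡fold p n s)

pair-suc : ∀ i j → pair i (suc j) ≡ suc (pair (suc i) j)
pair-suc i j = trans (cong (λ k → tri k + suc j) (+-suc i j)) (+-suc (tri (suc (i + j))) j)

pair-suc-zero : ∀ i → pair (suc i) 0 ≡ suc (pair 0 i)
pair-suc-zero i rewrite +-identityʳ i | +-identityʳ (i + tri i) = cong suc (+-comm i (tri i))

-- Codes ⟨ i , j ⟩ are kept opaque so that they stay symbolic under
-- normalisation and can be decoded by rewriting with π₁-⟨⟩ and π₂-⟨⟩.
opaque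
  ⟨_,_⟩ : ℕ → ℕ → ℕ
  ⟨_,_⟩ = pair

  ⟨⟩≡pair : ∀ i j → ⟨ i , j ⟩ ≡ pair i j
  ⟨⟩≡pair i j = refl

  private
    next : ℕ × ℕ → ℕ × ℕ
    next (zero  , j) = suc j , 0
    next (suc i , j) = i , suc j

    unpair : ℕ → ℕ × ℕ
    unpair zero    = 0 , 0
    unpair (suc x) = next (unpair x)

    pair-next : ∀ ij → pair (proj₁ (next ij)) (proj₂ (next ij)) ≡ suc (pair (proj₁ ij) (proj₂ ij))
    pair-next (zero  , j) = pair-suc-zero j
    pair-next (suc i , j) = pair-suc i j

    unpair-pair : ∀ s i j → i + j ≡ s → unpair (pair i j) ≡ (i , j)
    unpair-pair s       zero    zero    e = refl
    unpair-pair s       i       (suc j) e = trans (cong unpair (pair-suc i j))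
      (cong next (unpair-pair s (suc i) j (trans (sym (+-suc i j)) e)))
    unpair-pair (suc s) (suc i) zero    e = trans (cong unpair (pair-suc-zero i))
      (cong next (unpair-pair s zero i (trans (sym (+-identityʳ i)) (suc-injective e))))

  π₁ π₂ : ℕ → ℕ
  π₁ x = proj₁ (unpair x)
  π₂ x = proj₂ (unpair x)

  pair-π : ∀ x → pair (π₁ x) (π₂ x) ≡ x
  pair-π zero    = refl
  pair-π (suc x) = trans (pair-next (unpair x)) (cong suc (pair-π x))

  π₁-⟨⟩ : ∀ i j → π₁ ⟨ i , j ⟩ ≡ i
  π₁-⟨⟩ i j = cong proj₁ (unpair-pair _ i j refl)

  π₂-⟨⟩ : ∀ i j → π₂ ⟨ i , j ⟩ ≡ j
  π₂-⟨⟩ i j = cong proj₂ (unpair-pair _ i j refl)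

π₂≤ : ∀ x → π₂ x ≤ x
π₂≤ x = subst (π₂ x ≤_) (pair-π x) (m≤n+m (π₂ x) _)

⟨⟩ᶜ : Computable₂ (λ _ → ⟨_,_⟩)
⟨⟩ᶜ = computable-ext (app₂ +ᶜ (app₁ triᶜ (app₂ +ᶜ #0 #1)) #1) (λ p xs → sym (⟨⟩≡pair _ _))

-- The diagonal π₁ x + π₂ x of x is the least d with x < tri (suc d); this
-- search is the only use of minimisation.
diagonal : ℕ → ℕ
diagonal x = π₁ x + π₂ x

tri-mono-≤ : ∀ {m n} → m ≤ n → tri m ≤ tri n
tri-mono-≤ {zero}          _         = z≤n
tri-mono-≤ {suc m} {suc n} (s≤s m≤n) = +-mono-≤ (s≤s m≤n) (tri-mono-≤ m≤n)

tri-diagonal-≤ : ∀ x → tri (diagonal x) ≤ x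
tri-diagonal-≤ x = subst (tri (diagonal x) ≤_) (pair-π x) (m≤m+n _ _)

<-tri-suc-diagonal : ∀ x → x < tri (suc (diagonal x))
<-tri-suc-diagonal x = subst (_< suc (diagonal x) + tri (diagonal x)) (pair-π x)
  (subst (_< suc (diagonal x) + tri (diagonal x)) (+-comm (π₂ x) (tri (diagonal x)))
    (+-monoˡ-< (tri (diagonal x)) (s≤s (m≤n+m (π₂ x) (π₁ x)))))

diagonalᶜ : Computable₁ (λ _ → diagonal)
diagonalᶜ = minimiseᶜ (app₂ ∸ᶜ (app₁ sucᶜ #1) (app₁ triᶜ (app₁ sucᶜ #0))) _
  (λ { p (x ∷ []) → m≤n⇒m∸n≡0 (<-tri-suc-diagonal x) })
  (λ { p (x ∷ []) y y<d → x ∸ tri (suc y) , +-∸-assoc 1 (≤-trans (tri-mono-≤ y<d) (tri-diagonal-≤ x)) })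

π₂ᶜ : Computable₁ (λ _ → π₂)
π₂ᶜ = computable-ext (app₂ ∸ᶜ #0 (app₁ triᶜ diagonalᶜ)) λ { p (x ∷ []) →
  trans (cong (_∸ tri (diagonal x)) (sym (pair-π x))) (m+n∸m≡n (tri (diagonal x)) (π₂ x)) }

π₁ᶜ : Computable₁ (λ _ → π₁)
π₁ᶜ = computable-ext (app₂ ∸ᶜ diagonalᶜ π₂ᶜ) (λ { p (x ∷ []) → m+n∸n≡m (π₁ x) (π₂ x) })

fold-suc : ∀ {A : Set} (s : A) (f : A → A) n → fold s f (suc n) ≡ fold (f s) f n
fold-suc s f zero    = refl
fold-suc s f (suc n) = cong f (fold-suc s f n)

module Stabilising (f μ : ℕ → ℕ)
  (fixed : ∀ s → μ s ≡ 0 → f s ≡ s)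
  (decreasing : ∀ s k → μ s ≡ suc k → μ (f s) ≤ k) where

  fold-fixed : ∀ n s → μ s ≡ 0 → fold s f n ≡ s
  fold-fixed zero    s μs≡0 = refl
  fold-fixed (suc n) s μs≡0 = trans (cong f (fold-fixed n s μs≡0)) (fixed s μs≡0)

  fold-stable : ∀ n m s → μ s ≤ n → μ s ≤ m → fold s f n ≡ fold s f m
  fold-stable n m s μs≤n μs≤m with μ s in μs≡
  ... | zero = trans (fold-fixed n s μs≡) (sym (fold-fixed m s μs≡))
  fold-stable (suc n) (suc m) s (s≤s k≤n) (s≤s k≤m) | suc k =
    trans (fold-suc s f n)
      (trans (fold-stable n m (f s) (≤-trans (decreasing s k μs≡) k≤n) (≤-trans (decreasing s k μs≡) k≤m))
        (sym (fold-suc s f m)))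

  fold-step : ∀ {s t k} n → f s ≡ t → μ t ≡ k → k ≤ n → fold s f (suc n) ≡ fold t f k
  fold-step {s} {t} n fs≡t μt≡k k≤n = trans (fold-suc s f n) (trans (cong (λ u → fold u f n) fs≡t)
    (fold-stable n _ t (≤-trans (≤-reflexive μt≡k) k≤n) (≤-reflexive μt≡k)))

-- Subtrees of a δ_nK-name are addressed by lists of steps, coded by 0 = []
-- and cons m L = suc ⟨ m , L ⟩; step 0 enters p in 1p, step suc i enters
-- pᵢ in 2⟨p₀,p₁,…⟩.
cons : ℕ → ℕ → ℕ
cons m L = suc ⟨ m , L ⟩

lastStep parent : ℕ → ℕ
lastStep L = π₁ (pred L)
parent   L = π₂ (pred L)

shift : ℕ → ℕ → ℕ
shift m x = ifz m (suc x) (suc ⟨ pred m , x ⟩)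

ascend : ℕ → ℕ
ascend s = ifz (π₁ s) s ⟨ parent (π₁ s) , shift (lastStep (π₁ s)) (π₂ s) ⟩

-- Ascending to the root takes at most L steps, since parent L < L.
position : ℕ → ℕ → ℕ
position L x = π₂ (fold ⟨ L , x ⟩ ascend L)

label : Baire → ℕ → ℕ
label p L = p (position L 0)

SubtreeAt : Baire → ℕ → Baire → Set
SubtreeAt p L q = ∀ x → q x ≡ p (position L x)

-- A state codes a stream: ⟨ 0 , L ⟩ the translation of the subtree at L,
-- ⟨ 1 , L ⟩ the digit 1 followed by it, and ⟨ 2 , 0 ⟩ the name 000… of 0.
-- The continuation of component i + 1 of a limit is ⟨ 1 , L ⟩ for the address
-- L of component i, that of a tail or of component 0 is the continuation of
-- the parent, and that of the root is ⟨ 2 , 0 ⟩; seek returns suc L when it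
-- finds such an L and 0 when it reaches the root.
seekStep : ℕ → ℕ
seekStep s = ifz (π₁ s)
  (ifz (π₂ s) ⟨ 1 , 0 ⟩
    (ifz (pred (lastStep (π₂ s))) ⟨ 0 , parent (π₂ s) ⟩
      ⟨ 1 , suc (cons (pred (lastStep (π₂ s))) (parent (π₂ s))) ⟩))
  s

seek : ℕ → ℕ
seek L = π₂ (fold ⟨ 0 , L ⟩ seekStep (suc L))

continuation : ℕ → ℕ
continuation L = ifz (seek L) ⟨ 2 , 0 ⟩ ⟨ 1 , pred (seek L) ⟩

start : Baire → ℕ → ℕ
start p L = ifz (label p L) (continuation L) ⟨ 0 , L ⟩

firstDigit : Baire → ℕ → ℕ
firstDigit p s = ifz (π₁ s) (label p (π₂ s)) (ifz (pred (π₁ s)) 1 0)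

-- The state and position carrying digit suc m of the stream of s.
descend : Baire → ℕ → ℕ → ℕ
descend p s m = ifz (π₁ s)
  (ifz (pred (label p (π₂ s))) ⟨ start p (cons 0 (π₂ s)) , m ⟩
                               ⟨ ⟨ 1 , cons (suc (π₁ m)) (π₂ s) ⟩ , π₂ m ⟩)
  ⟨ start p (π₂ s) , m ⟩

walk : Baire → ℕ → ℕ
walk p t = ifz (π₂ t) t (descend p (π₁ t) (pred (π₂ t)))

digit : Baire → ℕ → ℕ → ℕ
digit p s n = firstDigit p (π₁ (fold ⟨ s , n ⟩ (walk p) n))

output : Baire → ℕ → ℕ
output p = digit p (start p 0)

consᶜ : Computable₂ (λ _ → cons)
consᶜ = app₁ sucᶜ ⟨⟩ᶜ

lastStepᶜ : Computable₁ (λ _ → lastStep)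
lastStepᶜ = app₁ π₁ᶜ predᶜ

parentᶜ : Computable₁ (λ _ → parent)
parentᶜ = app₁ π₂ᶜ predᶜ

shiftᶜ : Computable₂ (λ _ → shift)
shiftᶜ = app₃ ifzᶜ #0 (app₁ sucᶜ #1) (app₁ sucᶜ (app₂ ⟨⟩ᶜ (app₁ predᶜ #0) #1))

ascendᶜ : Computable₁ (λ _ → ascend)
ascendᶜ = app₃ ifzᶜ (app₁ π₁ᶜ #0) #0
  (app₂ ⟨⟩ᶜ (app₁ parentᶜ (app₁ π₁ᶜ #0)) (app₂ shiftᶜ (app₁ lastStepᶜ (app₁ π₁ᶜ #0)) (app₁ π₂ᶜ #0)))

positionᶜ : Computable₂ (λ _ → position)
positionᶜ = app₁ π₂ᶜ (app₂ (foldᶜ ascendᶜ) #0 (app₂ ⟨⟩ᶜ #0 #1))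

labelᶜ : Computable₁ label
labelᶜ = app₁ oracleᶜ (app₂ positionᶜ #0 zeroᶜ)

seekStepᶜ : Computable₁ (λ _ → seekStep)
seekStepᶜ = app₃ ifzᶜ (app₁ π₁ᶜ #0)
  (app₃ ifzᶜ (app₁ π₂ᶜ #0) (app₂ ⟨⟩ᶜ (constᶜ 1) (constᶜ 0))
    (app₃ ifzᶜ (app₁ predᶜ (app₁ lastStepᶜ (app₁ π₂ᶜ #0))) (app₂ ⟨⟩ᶜ (constᶜ 0) (app₁ parentᶜ (app₁ π₂ᶜ #0)))
      (app₂ ⟨⟩ᶜ (constᶜ 1) (app₁ sucᶜ (app₂ consᶜ (app₁ predᶜ (app₁ lastStepᶜ (app₁ π₂ᶜ #0)))
                                                  (app₁ parentᶜ (app₁ π₂ᶜ #0)))))))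
  #0

seekᶜ : Computable₁ (λ _ → seek)
seekᶜ = app₁ π₂ᶜ (app₂ (foldᶜ {λ _ → seekStep} seekStepᶜ) (app₁ sucᶜ #0) (app₂ ⟨⟩ᶜ (constᶜ 0) #0))

continuationᶜ : Computable₁ (λ _ → continuation)
continuationᶜ = app₃ ifzᶜ seekᶜ (app₂ ⟨⟩ᶜ (constᶜ 2) (constᶜ 0)) (app₂ ⟨⟩ᶜ (constᶜ 1) (app₁ predᶜ seekᶜ))

startᶜ : Computable₁ start
startᶜ = app₃ ifzᶜ labelᶜ continuationᶜ (app₂ ⟨⟩ᶜ (constᶜ 0) #0)

firstDigitᶜ : Computable₁ firstDigit
firstDigitᶜ = app₃ ifzᶜ (app₁ π₁ᶜ #0) (app₁ labelᶜ (app₁ π₂ᶜ #0))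
  (app₃ ifzᶜ (app₁ predᶜ (app₁ π₁ᶜ #0)) (constᶜ 1) (constᶜ 0))

descendᶜ : Computable₂ descend
descendᶜ = app₃ ifzᶜ (app₁ π₁ᶜ #0)
  (app₃ ifzᶜ (app₁ predᶜ (app₁ labelᶜ (app₁ π₂ᶜ #0)))
    (app₂ ⟨⟩ᶜ (app₁ startᶜ (app₂ consᶜ (constᶜ 0) (app₁ π₂ᶜ #0))) #1)
    (app₂ ⟨⟩ᶜ (app₂ ⟨⟩ᶜ (constᶜ 1) (app₂ consᶜ (app₁ sucᶜ (app₁ π₁ᶜ #1)) (app₁ π₂ᶜ #0))) (app₁ π₂ᶜ #1)))
  (app₂ ⟨⟩ᶜ (app₁ startᶜ (app₁ π₂ᶜ #0)) #1)

walkᶜ : Computable₁ walk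
walkᶜ = app₃ ifzᶜ (app₁ π₂ᶜ #0) #0 (app₂ descendᶜ (app₁ π₁ᶜ #0) (app₁ predᶜ (app₁ π₂ᶜ #0)))

outputᶜ : Computable₁ output
outputᶜ = app₁ firstDigitᶜ (app₁ π₁ᶜ (app₂ (foldᶜ walkᶜ) #0 (app₂ ⟨⟩ᶜ (app₁ startᶜ zeroᶜ) #0)))

≤ₒ-refl : ∀ a → a ≤ₒ a
≤ₒ-refl ozero    = z≤
≤ₒ-refl (osuc a) = s≤s (≤ₒ-refl a)
≤ₒ-refl (olim f) = lim≤ (λ i → ≤lim i (≤ₒ-refl (f i)))

≤ₒ-trans : ∀ {a b c} → a ≤ₒ b → b ≤ₒ c → a ≤ₒ c
≤ₒ-trans z≤        _         = z≤
≤ₒ-trans (lim≤ h)  b≤c       = lim≤ (λ i → ≤ₒ-trans (h i) b≤c)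
≤ₒ-trans (s≤s a≤b) (s≤s b≤c) = s≤s (≤ₒ-trans a≤b b≤c)
≤ₒ-trans (s≤s a≤b) (≤lim j q) = ≤lim j (≤ₒ-trans (s≤s a≤b) q)
≤ₒ-trans (≤lim i h) (lim≤ g)  = ≤ₒ-trans h (g i)
≤ₒ-trans (≤lim i h) (≤lim j q) = ≤lim j (≤ₒ-trans (≤lim i h) q)

≤ₒ-osuc : ∀ a → a ≤ₒ osuc a
≤ₒ-osuc ozero    = z≤
≤ₒ-osuc (osuc a) = s≤s (≤ₒ-osuc a)
≤ₒ-osuc (olim f) = lim≤ (λ i → ≤ₒ-trans (≤ₒ-osuc (f i)) (s≤s (≤lim i (≤ₒ-refl (f i)))))

≤ₒ-step : ∀ {a b} → a ≤ₒ b → a ≤ₒ osuc b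
≤ₒ-step {b = b} a≤b = ≤ₒ-trans a≤b (≤ₒ-osuc b)

K-ext : ∀ {q q′ β} → (∀ n → q n ≡ q′ n) → K q β → K q′ β
K-ext q≗q′ (k0 e)          = k0 (trans (sym (q≗q′ 0)) e)
K-ext q≗q′ (k1 e k)        = k1 (trans (sym (q≗q′ 0)) e) (K-ext (λ n → q≗q′ (suc n)) k)
K-ext q≗q′ (k2 αs e ks up) =
  k2 αs (trans (sym (q≗q′ 0)) e) (λ i → K-ext (λ j → q≗q′ (suc (pair i j))) (ks i)) up

ascend-fixed : ∀ s → π₁ s ≡ 0 → ascend s ≡ s
ascend-fixed s π₁s≡0 rewrite π₁s≡0 = refl

ascend-decreasing : ∀ s k → π₁ s ≡ suc k → π₁ (ascend s) ≤ k
ascend-decreasing s k π₁s≡1+k rewrite π₁s≡1+k | π₁-⟨⟩ (π₂ k) (shift (π₁ k) (π₂ s)) = π₂≤ k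

module Ascend = Stabilising ascend π₁ ascend-fixed ascend-decreasing

position-nil : ∀ x → position 0 x ≡ x
position-nil x = π₂-⟨⟩ 0 x

position-cons : ∀ m L x → position (cons m L) x ≡ position L (shift m x)
position-cons m L x = cong π₂ (Ascend.fold-step ⟨ m , L ⟩ ascend-cons (π₁-⟨⟩ L _) L≤⟨m,L⟩)
  where
  ascend-cons : ascend ⟨ cons m L , x ⟩ ≡ ⟨ L , shift m x ⟩
  ascend-cons rewrite π₁-⟨⟩ (cons m L) x | π₂-⟨⟩ (cons m L) x | π₁-⟨⟩ m L | π₂-⟨⟩ m L = refl
  L≤⟨m,L⟩ : L ≤ ⟨ m , L ⟩
  L≤⟨m,L⟩ = subst (L ≤_) (sym (⟨⟩≡pair m L)) (m≤n+m L _)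

subtree-root : ∀ p → SubtreeAt p 0 p
subtree-root p x = cong p (sym (position-nil x))

subtree-label : ∀ p L {q c} → SubtreeAt p L q → q 0 ≡ c → label p L ≡ c
subtree-label p L q≗ q0≡c = trans (sym (q≗ 0)) q0≡c

subtree-tail : ∀ p L {q} → SubtreeAt p L q → SubtreeAt p (cons 0 L) (tail q)
subtree-tail p L q≗ x = trans (q≗ (suc x)) (cong p (sym (position-cons 0 L x)))

subtree-comp : ∀ p L {q} → SubtreeAt p L q → ∀ i → SubtreeAt p (cons (suc i) L) (comp q i)
subtree-comp p L q≗ i x = trans (q≗ (suc (pair i x)))
  (cong p (trans (cong (λ j → position L (suc j)) (sym (⟨⟩≡pair i x))) (sym (position-cons (suc i) L x))))

remaining : ℕ → ℕ
remaining s = ifz (π₁ s) (suc (π₂ s)) 0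

seekStep-fixed : ∀ s → remaining s ≡ 0 → seekStep s ≡ s
seekStep-fixed s e with π₁ s
seekStep-fixed s () | zero
seekStep-fixed s e  | suc _ = refl

seekStep-decreasing : ∀ s k → remaining s ≡ suc k → remaining (seekStep s) ≤ k
seekStep-decreasing s k e with π₁ s | π₂ s
seekStep-decreasing s k () | suc _ | _
... | zero | zero rewrite π₁-⟨⟩ 1 0 = z≤n
... | zero | suc L with pred (lastStep (suc L))
... | zero rewrite π₁-⟨⟩ 0 (parent (suc L)) | π₂-⟨⟩ 0 (parent (suc L)) | sym (suc-injective e) = s≤s (π₂≤ L)
... | suc w rewrite π₁-⟨⟩ 1 (suc (cons (suc w) (π₂ L))) = z≤n

module Seek = Stabilising seekStep remaining seekStep-fixed seekStep-decreasing

seek-nil : seek 0 ≡ 0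
seek-nil rewrite π₁-⟨⟩ 0 0 | π₂-⟨⟩ 0 0 = π₂-⟨⟩ 1 0

seek-cons-low : ∀ m L → pred m ≡ 0 → seek (cons m L) ≡ seek L
seek-cons-low m L pred-m≡0 = cong π₂ (Seek.fold-step (cons m L) seekStep-low remaining-L (s≤s L≤⟨m,L⟩))
  where
  seekStep-low : seekStep ⟨ 0 , cons m L ⟩ ≡ ⟨ 0 , L ⟩
  seekStep-low rewrite π₁-⟨⟩ 0 (cons m L) | π₂-⟨⟩ 0 (cons m L) | π₁-⟨⟩ m L | π₂-⟨⟩ m L | pred-m≡0 = refl
  remaining-L : remaining ⟨ 0 , L ⟩ ≡ suc L
  remaining-L rewrite π₁-⟨⟩ 0 L | π₂-⟨⟩ 0 L = refl
  L≤⟨m,L⟩ : L ≤ ⟨ m , L ⟩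
  L≤⟨m,L⟩ = subst (L ≤_) (sym (⟨⟩≡pair m L)) (m≤n+m L _)

seek-cons-high : ∀ i L → seek (cons (suc (suc i)) L) ≡ suc (cons (suc i) L)
seek-cons-high i L =
  trans (cong π₂ (Seek.fold-step (cons (suc (suc i)) L) seekStep-high remaining-found z≤n)) (π₂-⟨⟩ 1 _)
  where
  seekStep-high : seekStep ⟨ 0 , cons (suc (suc i)) L ⟩ ≡ ⟨ 1 , suc (cons (suc i) L) ⟩
  seekStep-high rewrite π₁-⟨⟩ 0 (cons (suc (suc i)) L) | π₂-⟨⟩ 0 (cons (suc (suc i)) L)
                      | π₁-⟨⟩ (suc (suc i)) L | π₂-⟨⟩ (suc (suc i)) L = refl
  remaining-found : remaining ⟨ 1 , suc (cons (suc i) L) ⟩ ≡ 0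
  remaining-found rewrite π₁-⟨⟩ 1 (suc (cons (suc i) L)) = refl

continuation-nil : continuation 0 ≡ ⟨ 2 , 0 ⟩
continuation-nil rewrite seek-nil = refl

continuation-cons-low : ∀ m L → pred m ≡ 0 → continuation (cons m L) ≡ continuation L
continuation-cons-low m L pred-m≡0 rewrite seek-cons-low m L pred-m≡0 = refl

continuation-cons-high : ∀ i L → continuation (cons (suc (suc i)) L) ≡ ⟨ 1 , cons (suc i) L ⟩
continuation-cons-high i L rewrite seek-cons-high i L = refl

descend-π₂-≤ : ∀ p s m → π₂ (descend p s m) ≤ m
descend-π₂-≤ p s m = ifz-elim (λ t → π₂ t ≤ m) (π₁ s)
  (ifz-elim (λ t → π₂ t ≤ m) (pred (label p (π₂ s)))
    (≤-reflexive (π₂-⟨⟩ _ m)) (subst (_≤ m) (sym (π₂-⟨⟩ _ (π₂ m))) (π₂≤ m)))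
  (≤-reflexive (π₂-⟨⟩ _ m))

module Walk (p : Baire) where
  walk-fixed : ∀ t → π₂ t ≡ 0 → walk p t ≡ t
  walk-fixed t π₂t≡0 rewrite π₂t≡0 = refl

  walk-decreasing : ∀ t k → π₂ t ≡ suc k → π₂ (walk p t) ≤ k
  walk-decreasing t k π₂t≡1+k rewrite π₂t≡1+k = descend-π₂-≤ p (π₁ t) k

  open Stabilising (walk p) π₂ walk-fixed walk-decreasing public

digit-zero : ∀ p s → digit p s 0 ≡ firstDigit p s
digit-zero p s = cong (firstDigit p) (π₁-⟨⟩ s 0)

digit-suc : ∀ p {s s′ m m′} → descend p s m ≡ ⟨ s′ , m′ ⟩ → m′ ≤ m → digit p s (suc m) ≡ digit p s′ m′
digit-suc p {s} {s′} {m} {m′} descend≡ m′≤m =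
  cong (λ t → firstDigit p (π₁ t)) (Walk.fold-step p m walk≡ (π₂-⟨⟩ s′ m′) m′≤m)
  where
  walk≡ : walk p ⟨ s , suc m ⟩ ≡ ⟨ s′ , m′ ⟩
  walk≡ rewrite π₂-⟨⟩ s (suc m) | π₁-⟨⟩ s (suc m) = descend≡

start-inner : ∀ p L {k} → label p L ≡ suc k → start p L ≡ ⟨ 0 , L ⟩
start-inner p L lab rewrite lab = refl

K-continuation-cons-low : ∀ p {κ} m L → pred m ≡ 0 →
  K (digit p (continuation L)) κ → K (digit p (continuation (cons m L))) κ
K-continuation-cons-low p {κ} m L pred-m≡0 =
  subst (λ s → K (digit p s) κ) (sym (continuation-cons-low m L pred-m≡0))

K-continuation-root : ∀ p → K (digit p (continuation 0)) ozero
K-continuation-root p = subst (λ s → K (digit p s) ozero) (sym continuation-nil)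
  (k0 (trans (digit-zero p _) firstDigit-done))
  where
  firstDigit-done : firstDigit p ⟨ 2 , 0 ⟩ ≡ 0
  firstDigit-done rewrite π₁-⟨⟩ 2 0 = refl

K-tick : ∀ p L {β} → K (digit p (start p L)) β → K (digit p ⟨ 1 , L ⟩) (osuc β)
K-tick p L k = k1 (trans (digit-zero p _) firstDigit-tick)
  (K-ext (λ n → sym (digit-suc p (descend-tick n) ≤-refl)) k)
  where
  firstDigit-tick : firstDigit p ⟨ 1 , L ⟩ ≡ 1
  firstDigit-tick rewrite π₁-⟨⟩ 1 L = refl
  descend-tick : ∀ n → descend p ⟨ 1 , L ⟩ n ≡ ⟨ start p L , n ⟩
  descend-tick n rewrite π₁-⟨⟩ 1 L | π₂-⟨⟩ 1 L = refl

firstDigit-start : ∀ p L → firstDigit p ⟨ 0 , L ⟩ ≡ label p L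
firstDigit-start p L rewrite π₁-⟨⟩ 0 L | π₂-⟨⟩ 0 L = refl

K-succ : ∀ p L {β} → label p L ≡ 1 → K (digit p (start p (cons 0 L))) β → K (digit p (start p L)) (osuc β)
K-succ p L {β} lab k = subst (λ s → K (digit p s) (osuc β)) (sym (start-inner p L lab))
  (k1 (trans (digit-zero p _) (trans (firstDigit-start p L) lab))
      (K-ext (λ n → sym (digit-suc p (descend-succ n) ≤-refl)) k))
  where
  descend-succ : ∀ n → descend p ⟨ 0 , L ⟩ n ≡ ⟨ start p (cons 0 L) , n ⟩
  descend-succ n rewrite π₁-⟨⟩ 0 L | π₂-⟨⟩ 0 L | lab = refl

K-lim : ∀ p L {g : ℕ → Ord} → label p L ≡ 2 → (∀ i → K (digit p ⟨ 1 , cons (suc i) L ⟩) (g i)) →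
        (∀ i → g i <ₒ g (suc i)) → K (digit p (start p L)) (olim g)
K-lim p L {g} lab ks up = subst (λ s → K (digit p s) (olim g)) (sym (start-inner p L lab))
  (k2 g (trans (digit-zero p _) (trans (firstDigit-start p L) lab)) (λ i → K-ext (component i) (ks i)) up)
  where
  descend-lim : ∀ i j → descend p ⟨ 0 , L ⟩ ⟨ i , j ⟩ ≡ ⟨ ⟨ 1 , cons (suc i) L ⟩ , j ⟩
  descend-lim i j rewrite π₁-⟨⟩ 0 L | π₂-⟨⟩ 0 L | lab | π₁-⟨⟩ i j | π₂-⟨⟩ i j = refl
  component : ∀ i j → digit p ⟨ 1 , cons (suc i) L ⟩ j ≡ digit p ⟨ 0 , L ⟩ (suc (pair i j))
  component i j = sym (digit-suc p (subst (λ m → descend p ⟨ 0 , L ⟩ m ≡ ⟨ ⟨ 1 , cons (suc i) L ⟩ , j ⟩) (⟨⟩≡pair i j) (descend-lim i j))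
                                   (m≤n+m j _))

record NamesUpperBound (p : Baire) (s : ℕ) (α κ : Ord) : Set where
  constructor upperBound
  field
    ordinal       : Ord
    named         : K (digit p s) ordinal
    ≥value        : α ≤ₒ ordinal
    ≥continuation : κ ≤ₒ ordinal
open NamesUpperBound

bound-lim : ∀ p L (αs : ℕ → Ord) → label p L ≡ 2 →
  (∀ i κ → K (digit p (continuation (cons (suc i) L))) κ → NamesUpperBound p (start p (cons (suc i) L)) (αs i) κ) →
  ∀ κ → K (digit p (continuation L)) κ → NamesUpperBound p (start p L) (olim αs) κ
bound-lim p L αs lab bound-component κ kκ = upperBound (olim g)
  (K-lim p L lab (λ i → K-tick p (cons (suc i) L) (named (bound i))) (λ i → s≤s (≥continuation (bound (suc i)))))
  (lim≤ (λ i → ≤lim i (≤ₒ-step (≥value (bound i)))))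
  (≤lim 0 (≤ₒ-step (≥continuation (bound 0))))
  where
  mutual
    continued : ∀ i → Σ Ord λ c → K (digit p (continuation (cons (suc i) L))) c
    continued zero    = κ , K-continuation-cons-low p 1 L refl kκ
    continued (suc i) = osuc (ordinal (bound i)) , subst (λ s → K (digit p s) (osuc (ordinal (bound i))))
      (sym (continuation-cons-high i L)) (K-tick p (cons (suc i) L) (named (bound i)))

    bound : ∀ i → NamesUpperBound p (start p (cons (suc i) L)) (αs i) (proj₁ (continued i))
    bound i = bound-component i (proj₁ (continued i)) (proj₂ (continued i))

  g : ℕ → Ord
  g i = osuc (ordinal (bound i))

start-bound : ∀ p {q α} → NK q α → ∀ L → SubtreeAt p L q →
  ∀ κ → K (digit p (continuation L)) κ → NamesUpperBound p (start p L) α κ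
start-bound p (nk0 q0≡0) L q≗ κ kκ =
  upperBound κ (subst (λ s → K (digit p s) κ) (sym (start-leaf (subtree-label p L q≗ q0≡0))) kκ) z≤ (≤ₒ-refl κ)
  where
  start-leaf : label p L ≡ 0 → start p L ≡ continuation L
  start-leaf lab rewrite lab = refl
start-bound p (nk1 q0≡1 d) L q≗ κ kκ =
  let upperBound β kβ α≤β κ≤β = start-bound p d (cons 0 L) (subtree-tail p L q≗) κ (K-continuation-cons-low p 0 L refl kκ)
  in  upperBound (osuc β) (K-succ p L (subtree-label p L q≗ q0≡1) kβ) (s≤s α≤β) (≤ₒ-step κ≤β)
start-bound p (nk2 αs q0≡2 ds) L q≗ =
  bound-lim p L αs (subtree-label p L q≗ q0≡2) (λ i → start-bound p (ds i) (cons (suc i) L) (subtree-comp p L q≗ i))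

proposition44 : UpperBoundComputable
proposition44 = program outputᶜ , λ p α d →
  let upperBound β kβ α≤β _ = start-bound p d 0 (subtree-root p) ozero (K-continuation-root p)
  in  output p , (λ n → evaluates outputᶜ p (n ∷ [])) , β , kβ , α≤β
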